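{- Suppose $X\subseteq{^\omega}\omega$, $g\in{^\omega}\omega$, $n$ is a positive integer, and every $n$-coherent family of functions indexed by $X^n$ is $n$-trivial. Then every family indexed by $X^n$ that is $n$-coherent below $g$ is $n$-trivial below $g$.
   Context: For $f\in{^\omega}\omega$, $I(f)=\{(j,k)\in\omega^2\mid k\leq f(j)\}$. For $\vec f=(f_0,\dots,f_{m})$ in $({^\omega}\omega)^{m+1}$, $\wedge\vec f$ is the pointwise minimum, $\vec f^i$ is $\vec f$ with the $i$-th entry removed, and $\pi(\vec f)=(f_{\pi(0)},\dots,f_{\pi(m)})$ for a permutation $\pi$. For partial functions $\varphi,\psi:\omega^2\to\mathbb{Z}$, $\varphi=^*\psi$ means they differ at finitely many points of the common domain; sums are taken on the intersection of domains. A family $\Phi=\langle\varphi_{\vec f}:I(\wedge\vec f)\to\mathbb{Z}\mid\vec f\in X^n\rangle$ is $n$-coherent if it is alternating ($\varphi_{\pi(\vec f)}=\mathrm{sgn}(\pi)\varphi_{\vec f}$) and $\sum_{i=0}^n(-1)^i\varphi_{\vec f^i}=^*0$ for all $\vec f\in X^{n+1}$; it is $n$-trivial if, when $n=1$, there is $\psi:\omega^2\to\mathbb{Z}$ with $\psi=^*\varphi_f$ for all $f\in X$, and, when $n>1$, there is an alternating family $\langle\psi_{\vec f}:I(\wedge\vec f)\to\mathbb{Z}\mid\vec f\in X^{n-1}\rangle$ with $\sum_{i=0}^{n-1}(-1)^i\psi_{\vec f^i}=^*\varphi_{\vec f}$ for all $\vec f\in X^n$. A family $\langle\varphi_{\vec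 f}:I(\wedge\vec f)\cap I(g)\to\mathbb{Z}\mid\vec f\in X^n\rangle$ is $n$-coherent below $g$ if it satisfies the same alternating and coherence conditions (with these domains), and is $n$-trivial below $g$ if there is a $\psi:I(g)\to\mathbb{Z}$ (when $n=1$) or an alternating family $\langle\psi_{\vec f}:I(\wedge\vec f)\cap I(g)\to\mathbb{Z}\mid\vec f\in X^{n-1}\rangle$ (when $n>1$) satisfying the same trivializing equations. -}

module Defs where

open import Data.Nat using (ℕ; zero; suc; _≤_)
open import Data.Integer using (ℤ; 0ℤ; 1ℤ; -_; _+_; _*_)
open import Data.Fin using (Fin; zero; suc; punchIn; _<?_)
open import Data.Fin.Permutation using (Permutation′; _⟨$⟩ʳ_)
open import Data.Product using (Σ; ∃; _×_; proj₁)
open import Data.Sum using (_⊎_)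
open import Data.Bool using (if_then_else_)
open import Data.Empty using (⊥)
open import Data.Unit using (⊤)
open import Relation.Nullary using (does)
open import Relation.Binary.PropositionalEquality using (_≡_)

Fun : Set
Fun = ℕ → ℕ

Tup : (Fun → Set) → ℕ → Set
Tup X n = Fin n → Σ Fun X

InI : Fun → ℕ → ℕ → Set
InI f j k = k ≤ f j

-- (j,k) ∈ I(∧ v)  iff  k ≤ min_i v_i(j)  iff  ∀ i, k ≤ v_i(j)
InDom : ∀ {X n} → Tup X n → ℕ → ℕ → Set
InDom v j k = ∀ i → InI (proj₁ (v i)) j k

-- partial functions ω² → ℤ are represented by total functions; their
-- domain is always carried explicitly, and every condition below only
-- inspects values on the relevant domain.
PFun : Set
PFun = ℕ → ℕ → ℤ

-- φ =* ψ on the common domain D: they differ at only finitely many points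
-- of D (a subset of ω² is finite iff it is bounded).
EqStarOn : (ℕ → ℕ → Set) → PFun → PFun → Set
EqStarOn D φ ψ = ∃ λ N → ∀ j k → D j k → (N ≤ j ⊎ N ≤ k) → φ j k ≡ ψ j k

sumFin : ∀ n → (Fin n → ℤ) → ℤ
sumFin zero    a = 0ℤ
sumFin (suc n) a = a zero + sumFin n (λ i → a (suc i))

sumFinℕ : ∀ n → (Fin n → ℕ) → ℕ
sumFinℕ zero    a = 0
sumFinℕ (suc n) a = a zero Data.Nat.+ sumFinℕ n (λ i → a (suc i))

alt : ℕ → ℤ
alt zero    = 1ℤ
alt (suc k) = - alt k

altF : ∀ {n} → Fin n → ℤ
altF zero    = 1ℤ
altF (suc i) = - altF i

inversions : ∀ {n} → Permutation′ n → ℕ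
inversions {n} π =
  sumFinℕ n λ i → sumFinℕ n λ j →
    if does (i <? j) then (if does ((π ⟨$⟩ʳ j) <? (π ⟨$⟩ʳ i)) then 1 else 0) else 0

sgn : ∀ {n} → Permutation′ n → ℤ
sgn π = alt (inversions π)

permute : ∀ {X n} → Permutation′ n → Tup X n → Tup X n
permute π v i = v (π ⟨$⟩ʳ i)

remove : ∀ {X n} → Fin (suc n) → Tup X (suc n) → Tup X n
remove i v j = v (punchIn i j)

-- Families indexed by X^n.  The extra restriction B is ⊤ for plain families
-- (domains I(∧v)) and I(g) for families "below g" (domains I(∧v) ∩ I(g)).
Family : (Fun → Set) → ℕ → Set
Family X n = Tup X n → PFun

Dom : ∀ {X n} → (ℕ → ℕ → Set) → Tup X n → ℕ → ℕ → Set
Dom B v j k = InDom v j k × B j k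

Alternating : ∀ {X n} → (ℕ → ℕ → Set) → Family X n → Set
Alternating {X} {n} B Φ =
  (v : Tup X n) (π : Permutation′ n) → ∀ j k → Dom B v j k →
    Φ (permute π v) j k ≡ sgn π * Φ v j k

δ : ∀ {X n} → Family X n → Tup X (suc n) → PFun
δ {n = n} Φ v j k = sumFin (suc n) λ i → altF i * Φ (remove i v) j k

CommonDom : ∀ {X n} → (ℕ → ℕ → Set) → Tup X (suc n) → ℕ → ℕ → Set
CommonDom B v j k = ∀ i → Dom B (remove i v) j k

CoherentR : ∀ {X} n → (ℕ → ℕ → Set) → Family X n → Set
CoherentR {X} n B Φ =
  Alternating B Φ ×
  ((v : Tup X (suc n)) → EqStarOn (CommonDom B v) (δ Φ v) (λ _ _ → 0ℤ))

TrivialR : ∀ {X} n → (ℕ → ℕ → Set) → Family X n → Set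
TrivialR zero B Φ = ⊥   -- n is required to be positive; never used
TrivialR {X} (suc zero) B Φ =
  ∃ λ (ψ : PFun) → (v : Tup X 1) →
    EqStarOn (λ j k → B j k × Dom B v j k) ψ (Φ v)
TrivialR {X} (suc (suc m)) B Φ =
  ∃ λ (Ψ : Family X (suc m)) → Alternating B Ψ ×
    ((v : Tup X (suc (suc m))) →
       EqStarOn (λ j k → CommonDom B v j k × Dom B v j k) (δ Ψ v) (Φ v))

Coherent : ∀ {X} n → Family X n → Set
Coherent n = CoherentR n (λ _ _ → ⊤)

Trivial : ∀ {X} n → Family X n → Set
Trivial n = TrivialR n (λ _ _ → ⊤)

CoherentBelow : ∀ {X} n → Fun → Family X n → Set
CoherentBelow n g = CoherentR n (InI g)

TrivialBelow : ∀ {X} n → Fun → Family X n → Set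
TrivialBelow n g = TrivialR n (InI g)

module Submission where

-- Extend a family that is coherent below g by 0 outside I(g).  Both sides of
-- each coherence equation vanish outside I(g) and are unchanged inside it, so
-- the extension is coherent, hence trivial by hypothesis; restricting a
-- trivialization of the extension to I(g) trivializes the original family.

open import Defs
open import Data.Nat using (ℕ; zero; suc; _≤_; _≤?_)
open import Data.Integer using (ℤ; 0ℤ; _+_; _*_)
open import Data.Integer.Properties using (*-zeroʳ)
open import Data.Fin using (Fin; zero; suc)
open import Data.Product using (_,_; proj₁)
open import Data.Sum using (_⊎_)
open import Data.Unit using (⊤; tt)
open import Data.Empty using (⊥-elim)
open import Relation.Nullary using (¬_; Dec; yes; no)
open import Relation.Binary.PropositionalEquality using (_≡_; refl; sym; trans; cong; cong₂)

Pred² : Set₁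
Pred² = ℕ → ℕ → Set

sumFin-cong : ∀ n {a b : Fin n → ℤ} → (∀ i → a i ≡ b i) → sumFin n a ≡ sumFin n b
sumFin-cong zero    a≡b = refl
sumFin-cong (suc n) a≡b = cong₂ _+_ (a≡b zero) (sumFin-cong n (λ i → a≡b (suc i)))

sumFin-zero : ∀ n {a : Fin n → ℤ} → (∀ i → a i ≡ 0ℤ) → sumFin n a ≡ 0ℤ
sumFin-zero zero    a≡0 = refl
sumFin-zero (suc n) a≡0 = cong₂ _+_ (a≡0 zero) (sumFin-zero n (λ i → a≡0 (suc i)))

EqStarOn-mono : ∀ {D D′ : Pred²} {φ ψ : PFun} →
  (∀ j k → D′ j k → D j k) → EqStarOn D φ ψ → EqStarOn D′ φ ψ
EqStarOn-mono D′⊆D (N , eq) = N , λ j k d′ far → eq j k (D′⊆D j k d′) far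

EqStarOn-respʳ : ∀ {D : Pred²} {φ ψ ψ′ : PFun} →
  (∀ j k → D j k → ψ j k ≡ ψ′ j k) → EqStarOn D φ ψ → EqStarOn D φ ψ′
EqStarOn-respʳ ψ≡ψ′ (N , eq) = N , λ j k d far → trans (eq j k d far) (ψ≡ψ′ j k d)

Alternating-mono : ∀ {X n} {B B′ : Pred²} {Φ : Family X n} →
  (∀ j k → B′ j k → B j k) → Alternating B Φ → Alternating B′ Φ
Alternating-mono B′⊆B alt v π j k (d , b′) = alt v π j k (d , B′⊆B j k b′)

trivial⇒trivialR : ∀ {X} n (B : Pred²) {Φ : Family X n} → Trivial n Φ → TrivialR n B Φ
trivial⇒trivialR zero          B ()
trivial⇒trivialR (suc zero)    B (ψ , triv) =
  ψ , λ v → EqStarOn-mono (λ j k (_ , d , _) → tt , d , tt) (triv v)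
trivial⇒trivialR (suc (suc m)) B (Ψ , alt , triv) =
  Ψ , Alternating-mono (λ _ _ _ → tt) alt ,
  λ v → EqStarOn-mono (λ j k (cd , d , _) → (λ i → proj₁ (cd i) , tt) , d , tt) (triv v)

trivialR-resp : ∀ {X} n (B : Pred²) {Φ Φ′ : Family X n} →
  (∀ v j k → B j k → Φ v j k ≡ Φ′ v j k) → TrivialR n B Φ → TrivialR n B Φ′
trivialR-resp zero          B Φ≡Φ′ ()
trivialR-resp (suc zero)    B Φ≡Φ′ (ψ , triv) =
  ψ , λ v → EqStarOn-respʳ (λ j k (b , _) → Φ≡Φ′ v j k b) (triv v)
trivialR-resp (suc (suc m)) B Φ≡Φ′ (Ψ , alt , triv) =
  Ψ , alt , λ v → EqStarOn-respʳ (λ j k (_ , _ , b) → Φ≡Φ′ v j k b) (triv v)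

extendByZero : ∀ {X n} → Fun → Family X n → Family X n
extendByZero g Φ v j k with k ≤? g j
... | yes _ = Φ v j k
... | no  _ = 0ℤ

module _ {X : Fun → Set} {n : ℕ} (g : Fun) (Φ : Family X n) where

  extendByZero-inside : ∀ v {j k} → InI g j k → extendByZero g Φ v j k ≡ Φ v j k
  extendByZero-inside v {j} {k} k≤gj with k ≤? g j
  ... | yes _    = refl
  ... | no  k≰gj = ⊥-elim (k≰gj k≤gj)

  extendByZero-outside : ∀ v {j k} → ¬ InI g j k → extendByZero g Φ v j k ≡ 0ℤ
  extendByZero-outside v {j} {k} k≰gj with k ≤? g j
  ... | yes k≤gj = ⊥-elim (k≰gj k≤gj)
  ... | no  _    = refl

  δ-extendByZero-inside : ∀ (v : Tup X (suc n)) {j k} → InI g j k →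
    δ (extendByZero g Φ) v j k ≡ δ Φ v j k
  δ-extendByZero-inside v k≤gj =
    sumFin-cong (suc n) λ i → cong (altF i *_) (extendByZero-inside (remove i v) k≤gj)

  δ-extendByZero-outside : ∀ (v : Tup X (suc n)) {j k} → ¬ InI g j k →
    δ (extendByZero g Φ) v j k ≡ 0ℤ
  δ-extendByZero-outside v k≰gj = sumFin-zero (suc n) λ i →
    trans (cong (altF i *_) (extendByZero-outside (remove i v) k≰gj)) (*-zeroʳ (altF i))

  extendByZero-coherent : CoherentBelow n g Φ → Coherent n (extendByZero g Φ)
  extendByZero-coherent (alt , coh) = alt⁰ , coh⁰
    where
    alt⁰ : Alternating (λ _ _ → ⊤) (extendByZero g Φ)
    alt⁰ v π j k (d , _) with k ≤? g j
    ... | yes k≤gj = alt v π j k (d , k≤gj)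
    ... | no  _    = sym (*-zeroʳ (sgn π))

    coh⁰ : (v : Tup X (suc n)) →
      EqStarOn (CommonDom (λ _ _ → ⊤) v) (δ (extendByZero g Φ) v) (λ _ _ → 0ℤ)
    coh⁰ v with coh v
    ... | N , δΦ≡0 = N , λ j k cd far → pointwise j k cd far (k ≤? g j)
      where
      pointwise : ∀ j k → CommonDom (λ _ _ → ⊤) v j k → N ≤ j ⊎ N ≤ k → Dec (k ≤ g j) →
        δ (extendByZero g Φ) v j k ≡ 0ℤ
      pointwise j k cd far (yes k≤gj) = trans (δ-extendByZero-inside v k≤gj)
        (δΦ≡0 j k (λ i → proj₁ (cd i) , k≤gj) far)
      pointwise j k cd far (no k≰gj) = δ-extendByZero-outside v k≰gj

proposition4p2 : (X : Fun → Set) (g : Fun) (n : ℕ) → 1 ≤ n →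
    ((Φ : Family X n) → Coherent n Φ → Trivial n Φ) →
    (Φ : Family X n) → CoherentBelow n g Φ → TrivialBelow n g Φ
proposition4p2 X g n _ coherent⇒trivial Φ coherentBelow =
  trivialR-resp n (InI g) (λ v j k → extendByZero-inside g Φ v)
    (trivial⇒trivialR n (InI g)
      (coherent⇒trivial (extendByZero g Φ) (extendByZero-coherent g Φ coherentBelow)))
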